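{- As $n\to\infty$, $$M_{\mathrm{Schur}}(n,3) \le \frac{n^2}{67} + O(n), \qquad M_{\mathrm{Schur}}(n,4) \le \frac{n^2}{496} + O(n).$$
   Context: For a positive integer $n$, $[n]=\{1,\dots,n\}$. A solution of $x+y=z$ in $[n]$ is an ordered triple $(x,y,z)\in[n]^3$ with $x+y=z$; $(x,y,z)$ and $(y,x,z)$ with $x\ne y$ are counted as different solutions (no requirement $x\le y$). For a $k$-coloring $\chi$ of $[n]$, a solution is monochromatic if $\chi(x)=\chi(y)=\chi(z)$. $M_{\mathrm{Schur}}(n,k)$ denotes the minimum, over all $k$-colorings of $[n]$, of the number of monochromatic solutions of $x+y=z$. -}

module Defs where

open import Data.Nat using (ℕ; zero; suc; _+_; _*_; _^_)
open import Data.Nat.Properties using (≤-totalOrder)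
import Data.Nat.Properties as ℕₚ
open import Data.Fin using (Fin; toℕ)
import Data.Fin.Properties as Finₚ
open import Data.Vec using (Vec; []; _∷_; lookup)
open import Data.List using (List; []; _∷_; [_]; length; filter; allFin; cartesianProduct; cartesianProductWith)
open import Data.Product using (_×_; _,_)
open import Relation.Nullary using (Dec)
open import Relation.Nullary.Decidable using (_×-dec_)
open import Relation.Binary.PropositionalEquality using (_≡_)
open import Data.List.Extrema ≤-totalOrder using (min)

-- A k-coloring of [n] = {1,…,n}: the element i ∈ [n] is represented by
-- the index (i - 1) : Fin n, and its colour is the (i-1)-th entry.
Coloring : ℕ → ℕ → Set
Coloring n k = Vec (Fin k) n

val : ∀ {n} → Fin n → ℕ
val i = suc (toℕ i)

IsMonoSol : ∀ {n k} → Coloring n k → Fin n × Fin n × Fin n → Set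
IsMonoSol χ (x , y , z) =
  (val x + val y ≡ val z) × (lookup χ x ≡ lookup χ y) × (lookup χ y ≡ lookup χ z)

isMonoSol? : ∀ {n k} (χ : Coloring n k) (t : Fin n × Fin n × Fin n) → Dec (IsMonoSol χ t)
isMonoSol? χ (x , y , z) =
  (val x + val y ℕₚ.≟ val z) ×-dec (lookup χ x Finₚ.≟ lookup χ y) ×-dec (lookup χ y Finₚ.≟ lookup χ z)

triples : ∀ n → List (Fin n × Fin n × Fin n)
triples n = cartesianProduct (allFin n) (cartesianProduct (allFin n) (allFin n))

monoCount : ∀ {n k} → Coloring n k → ℕ
monoCount {n} χ = length (filter (isMonoSol? χ) (triples n))

allColorings : ∀ n k → List (Coloring n k)
allColorings zero    k = [ [] ]
allColorings (suc n) k = cartesianProductWith _∷_ (allFin k) (allColorings n k)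

-- The start value n^3 bounds every monoCount (there are n^3 triples),
-- so for k ≥ 1 this is exactly the minimum over the (nonempty) list of colorings.
MSchur : ℕ → ℕ → ℕ
MSchur n k = min (n ^ 3) (Data.List.map monoCount (allColorings n k))
  where import Data.List

-- Colour {0,…,L−1} by a template c and blow it up by a factor T, giving a the colour of ⌊a/T⌋.
-- Write a = iT + p and b = jT + q with p, q < T: the point 1 + a + b lies in block i + j when
-- 1 + p + q < T and in block i + j + 1 otherwise. So every monochromatic Schur solution of the
-- blow-up lies over a monochromatic solution of i + j = z or of 1 + i + j = z in the template, and
-- since T(T − 1)/2 offset pairs (p, q) fall in the first case and T(T + 1)/2 in the second, the
-- blow-up has at most (A + B)(T² + T)/2 of them, A and B counting the template's solutions of the two
-- equations. The templates of length L = 67 (three colours) and L = 496 (four colours) have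
-- A + B = 2L; blowing them up by T = ⌊n/L⌋ + 1 and restricting to [n] gives
-- L · M(n,k) ≤ L²(T² + T) ≤ (n + L)² + L(n + L).
module Submission where

open import Data.Bool.Base using (true; false; if_then_else_)
open import Data.Fin.Base using (Fin; toℕ)
open import Data.Fin.Patterns using (0F; 1F; 2F; 3F)
open import Data.Fin.Properties using () renaming (_≟_ to _≟ᶠ_)
open import Data.List.Base
  using (List; []; _∷_; _++_; length; map; filter; tabulate; allFin; cartesianProduct)
open import Data.List.Properties using (map-++; map-∘; map-tabulate)
open import Data.List.Membership.Propositional using (_∈_)
open import Data.List.Membership.Propositional.Properties
  using (∈-map⁺; ∈-allFin; ∈-cartesianProductWith⁺)
open import Data.List.Relation.Unary.Any as Any using (here)
open import Data.Nat.Base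
open import Data.Nat.Properties
open import Data.List.Extrema ≤-totalOrder using (min≤v⁺)
open import Algebra.Properties.CommutativeSemigroup +-commutativeSemigroup using (interchange)
open import Data.Nat.DivMod
open import Data.Nat.ListAction using (sum)
open import Data.Nat.ListAction.Properties using (sum-++)
open import Data.Nat.Divisibility using (n∣m*n)
open import Data.Nat.Tactic.RingSolver using (solve-∀)
open import Data.Product.Base using (_×_; _,_; ∃-syntax)
open import Data.Sum.Base using (inj₂)
open import Data.Vec.Base as Vec using ([]; _∷_; lookup)
open import Data.Vec.Properties using (lookup∘tabulate)
open import Function.Base using (_∘_; id)
open import Relation.Nullary using (Dec; does; yes; no; ¬_; contradiction)
open import Relation.Nullary.Decidable using (from-yes)
open import Relation.Unary using (Decidable)
open import Relation.Binary.PropositionalEquality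
open ≤-Reasoning

open import Defs

-- Only 'does' is inspected, so indicators of decidable arithmetic facts compute by evaluation.
𝟙 : ∀ {p} {P : Set p} → Dec P → ℕ
𝟙 P? = if does P? then 1 else 0

𝟙-yes : ∀ {p} {P : Set p} (P? : Dec P) → P → 𝟙 P? ≡ 1
𝟙-yes (yes _) _ = refl
𝟙-yes (no ¬p) p = contradiction p ¬p

𝟙-no : ∀ {p} {P : Set p} (P? : Dec P) → ¬ P → 𝟙 P? ≡ 0
𝟙-no (yes p) ¬p = contradiction p ¬p
𝟙-no (no _)  _  = refl

𝟙≤ : ∀ {p} {P : Set p} (P? : Dec P) {m} → (P → 1 ≤ m) → 𝟙 P? ≤ m
𝟙≤ (yes p) P⇒1≤m = P⇒1≤m p
𝟙≤ (no _)  _     = z≤n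

𝟙-mono : ∀ {p q} {P : Set p} {Q : Set q} (P? : Dec P) (Q? : Dec Q) → (P → Q) → 𝟙 P? ≤ 𝟙 Q?
𝟙-mono P? Q? P⇒Q = 𝟙≤ P? (λ p → ≤-reflexive (sym (𝟙-yes Q? (P⇒Q p))))

𝟙-cong : ∀ {p q} {P : Set p} {Q : Set q} (P? : Dec P) (Q? : Dec Q) → (P → Q) → (Q → P) → 𝟙 P? ≡ 𝟙 Q?
𝟙-cong P? Q? P⇒Q Q⇒P = ≤-antisym (𝟙-mono P? Q? P⇒Q) (𝟙-mono Q? P? Q⇒P)

𝟙[<]+𝟙[≥] : ∀ m n → 𝟙 (m <? n) + 𝟙 (n ≤? m) ≡ 1
𝟙[<]+𝟙[≥] m n with m <? n
... | yes m<n = cong₂ _+_ (𝟙-yes (m <? n) m<n) (𝟙-no (n ≤? m) (<⇒≱ m<n))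
... | no  m≮n = cong₂ _+_ (𝟙-no (m <? n) m≮n) (𝟙-yes (n ≤? m) (≮⇒≥ m≮n))

∑ : ℕ → (ℕ → ℕ) → ℕ
∑ zero    f = 0
∑ (suc n) f = ∑ n f + f n

-- ∑[ i < n ] binds looser than + and *: its body extends over sums and products.
infix 5 ∑
syntax ∑ n (λ i → e) = ∑[ i < n ] e

∑-cong : ∀ n {f g : ℕ → ℕ} → (∀ i → i < n → f i ≡ g i) → ∑ n f ≡ ∑ n g
∑-cong zero    f≡g = refl
∑-cong (suc n) f≡g = cong₂ _+_ (∑-cong n λ i i<n → f≡g i (m<n⇒m<1+n i<n)) (f≡g n (n<1+n n))

∑-monoʳ-≤ : ∀ n {f g : ℕ → ℕ} → (∀ i → i < n → f i ≤ g i) → ∑ n f ≤ ∑ n g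
∑-monoʳ-≤ zero    f≤g = z≤n
∑-monoʳ-≤ (suc n) f≤g = +-mono-≤ (∑-monoʳ-≤ n λ i i<n → f≤g i (m<n⇒m<1+n i<n)) (f≤g n (n<1+n n))

∑-const : ∀ n c → ∑[ i < n ] c ≡ n * c
∑-const zero    c = refl
∑-const (suc n) c = trans (cong (_+ c) (∑-const n c)) (+-comm (n * c) c)

∑-+ : ∀ n (f g : ℕ → ℕ) → ∑[ i < n ] f i + g i ≡ ∑ n f + ∑ n g
∑-+ zero    f g = refl
∑-+ (suc n) f g = trans (cong (_+ (f n + g n)) (∑-+ n f g)) (interchange (∑ n f) (∑ n g) (f n) (g n))

∑-*ˡ : ∀ n c (f : ℕ → ℕ) → ∑[ i < n ] c * f i ≡ c * ∑ n f
∑-*ˡ zero    c f = sym (*-zeroʳ c)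
∑-*ˡ (suc n) c f = trans (cong (_+ c * f n) (∑-*ˡ n c f)) (sym (*-distribˡ-+ c (∑ n f) (f n)))

∑-*ʳ : ∀ n c (f : ℕ → ℕ) → ∑[ i < n ] f i * c ≡ ∑ n f * c
∑-*ʳ n c f = trans (∑-cong n (λ i _ → *-comm (f i) c)) (trans (∑-*ˡ n c f) (*-comm c _))

∑-comm : ∀ m n (f : ℕ → ℕ → ℕ) → ∑[ i < m ] ∑[ j < n ] f i j ≡ ∑[ j < n ] ∑[ i < m ] f i j
∑-comm zero    n f = sym (trans (∑-const n 0) (*-zeroʳ n))
∑-comm (suc m) n f = trans (cong (_+ ∑ n (f m)) (∑-comm m n f)) (sym (∑-+ n (λ j → ∑[ i < m ] f i j) (f m)))

∑-++ : ∀ m n (f : ℕ → ℕ) → ∑ (m + n) f ≡ ∑ m f + (∑[ i < n ] f (m + i))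
∑-++ m zero    f = trans (cong (λ k → ∑ k f) (+-identityʳ m)) (sym (+-identityʳ (∑ m f)))
∑-++ m (suc n) f = begin-equality
  ∑ (m + suc n) f                                 ≡⟨ cong (λ k → ∑ k f) (+-suc m n) ⟩
  ∑ (m + n) f + f (m + n)                         ≡⟨ cong (_+ f (m + n)) (∑-++ m n f) ⟩
  ∑ m f + (∑[ i < n ] f (m + i)) + f (m + n)      ≡⟨ +-assoc (∑ m f) _ (f (m + n)) ⟩
  ∑ m f + (∑[ i < suc n ] f (m + i))              ∎

∑-head : ∀ n (f : ℕ → ℕ) → ∑ (suc n) f ≡ f 0 + (∑[ i < n ] f (suc i))
∑-head = ∑-++ 1

∑-monoˡ-≤ : ∀ {m n} (f : ℕ → ℕ) → m ≤ n → ∑ m f ≤ ∑ n f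
∑-monoˡ-≤ {m} {n} f m≤n = begin
  ∑ m f                                     ≤⟨ m≤m+n (∑ m f) _ ⟩
  ∑ m f + (∑[ i < n ∸ m ] f (m + i))        ≡⟨ ∑-++ m (n ∸ m) f ⟨
  ∑ (m + (n ∸ m)) f                         ≡⟨ cong (λ k → ∑ k f) (m+[n∸m]≡n m≤n) ⟩
  ∑ n f                                     ∎

∑-blocks : ∀ L T (f : ℕ → ℕ) → ∑ (L * T) f ≡ ∑[ i < L ] ∑[ p < T ] f (i * T + p)
∑-blocks zero    T f = refl
∑-blocks (suc L) T f = begin-equality
  ∑ (T + L * T) f                                         ≡⟨ cong (λ k → ∑ k f) (+-comm T (L * T)) ⟩
  ∑ (L * T + T) f                                         ≡⟨ ∑-++ (L * T) T f ⟩
  ∑ (L * T) f + (∑[ p < T ] f (L * T + p))                ≡⟨ cong (_+ (∑[ p < T ] f (L * T + p))) (∑-blocks L T f) ⟩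
  (∑[ i < L ] ∑[ p < T ] f (i * T + p)) + (∑[ p < T ] f (L * T + p)) ∎

∑-𝟙[≡] : ∀ n s → ∑[ z < n ] 𝟙 (z ≟ s) ≡ 𝟙 (s <? n)
∑-𝟙[≡] zero    s       = refl
∑-𝟙[≡] (suc n) zero    = trans (∑-head n _) (cong suc (trans (∑-const n 0) (*-zeroʳ n)))
∑-𝟙[≡] (suc n) (suc s) = trans (∑-head n _) (∑-𝟙[≡] n s)

∑-𝟙[≤] : ∀ n m → ∑[ q < n ] 𝟙 (m ≤? q) ≡ n ∸ m
∑-𝟙[≤] zero    m       = sym (0∸n≡0 m)
∑-𝟙[≤] (suc n) zero    = trans (∑-head n _) (cong suc (trans (∑-const n 1) (*-identityʳ n)))
∑-𝟙[≤] (suc n) (suc m) = trans (∑-head n _) (trans (∑-cong n λ q _ → 𝟙[suc≤suc] m q) (∑-𝟙[≤] n m))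
  where
  𝟙[suc≤suc] : ∀ m q → 𝟙 (suc m ≤? suc q) ≡ 𝟙 (m ≤? q)
  𝟙[suc≤suc] zero    q = refl
  𝟙[suc≤suc] (suc m) q = refl

double-∑-suc : ∀ n → 2 * ∑ n suc ≡ n * n + n
double-∑-suc zero    = refl
double-∑-suc (suc n) = begin-equality
  2 * (∑ n suc + suc n)        ≡⟨ *-distribˡ-+ 2 (∑ n suc) (suc n) ⟩
  2 * ∑ n suc + 2 * suc n      ≡⟨ cong (_+ 2 * suc n) (double-∑-suc n) ⟩
  n * n + n + 2 * suc n        ≡⟨ collect n ⟩
  suc n * suc n + suc n        ∎
  where
  collect : ∀ n → n * n + n + 2 * suc n ≡ suc n * suc n + suc n
  collect = solve-∀

∑² : ℕ → (ℕ → ℕ → ℕ) → ℕ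
∑² n f = ∑[ i < n ] ∑[ j < n ] f i j

infix 5 ∑²
syntax ∑² n (λ i j → e) = ∑²[ i , j < n ] e

∑²-cong : ∀ n {f g : ℕ → ℕ → ℕ} → (∀ i j → i < n → j < n → f i j ≡ g i j) → ∑² n f ≡ ∑² n g
∑²-cong n f≡g = ∑-cong n λ i i<n → ∑-cong n λ j j<n → f≡g i j i<n j<n

∑²-monoʳ-≤ : ∀ n {f g : ℕ → ℕ → ℕ} → (∀ i j → i < n → j < n → f i j ≤ g i j) → ∑² n f ≤ ∑² n g
∑²-monoʳ-≤ n f≤g = ∑-monoʳ-≤ n λ i i<n → ∑-monoʳ-≤ n λ j j<n → f≤g i j i<n j<n

∑²-monoˡ-≤ : ∀ {m n} (f : ℕ → ℕ → ℕ) → m ≤ n → ∑² m f ≤ ∑² n f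
∑²-monoˡ-≤ {m} {n} f m≤n = begin
  ∑²[ i , j < m ] f i j            ≤⟨ ∑-monoʳ-≤ m (λ i _ → ∑-monoˡ-≤ (f i) m≤n) ⟩
  ∑[ i < m ] ∑[ j < n ] f i j      ≤⟨ ∑-monoˡ-≤ _ m≤n ⟩
  ∑²[ i , j < n ] f i j            ∎

∑²-const : ∀ n c → ∑²[ i , j < n ] c ≡ n * n * c
∑²-const n c = begin-equality
  ∑[ i < n ] ∑[ j < n ] c   ≡⟨ ∑-cong n (λ i _ → ∑-const n c) ⟩
  ∑[ i < n ] (n * c)        ≡⟨ ∑-const n (n * c) ⟩
  n * (n * c)               ≡⟨ *-assoc n n c ⟨
  n * n * c                 ∎

∑²-+ : ∀ n (f g : ℕ → ℕ → ℕ) → ∑²[ i , j < n ] (f i j + g i j) ≡ ∑² n f + ∑² n g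
∑²-+ n f g = trans (∑-cong n λ i _ → ∑-+ n (f i) (g i)) (∑-+ n _ _)

∑²-*ˡ : ∀ n c (f : ℕ → ℕ → ℕ) → ∑²[ i , j < n ] (c * f i j) ≡ c * ∑² n f
∑²-*ˡ n c f = trans (∑-cong n λ i _ → ∑-*ˡ n c (f i)) (∑-*ˡ n c _)

∑²-*ʳ : ∀ n c (f : ℕ → ℕ → ℕ) → ∑²[ i , j < n ] (f i j * c) ≡ ∑² n f * c
∑²-*ʳ n c f = trans (∑-cong n λ i _ → ∑-*ʳ n c (f i)) (∑-*ʳ n c _)

∑²-blocks : ∀ L T (f : ℕ → ℕ → ℕ) →
            ∑² (L * T) f ≡ ∑²[ i , j < L ] ∑²[ p , q < T ] f (i * T + p) (j * T + q)
∑²-blocks L T f = begin-equality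
  ∑[ a < L * T ] ∑[ b < L * T ] f a b
    ≡⟨ ∑-cong (L * T) (λ a _ → ∑-blocks L T (f a)) ⟩
  ∑[ a < L * T ] ∑[ j < L ] ∑[ q < T ] f a (j * T + q)
    ≡⟨ ∑-blocks L T _ ⟩
  ∑[ i < L ] ∑[ p < T ] ∑[ j < L ] ∑[ q < T ] f (i * T + p) (j * T + q)
    ≡⟨ ∑-cong L (λ i _ → ∑-comm T L _) ⟩
  ∑[ i < L ] ∑[ j < L ] ∑[ p < T ] ∑[ q < T ] f (i * T + p) (j * T + q) ∎

monochromatic : ∀ {k} → (ℕ → Fin k) → ℕ → ℕ → ℕ → ℕ
monochromatic c x y z = 𝟙 (c x ≟ᶠ c y) * 𝟙 (c y ≟ᶠ c z)

schurTerm : ∀ {k} → (ℕ → Fin k) → ℕ → ℕ → ℕ → ℕ → ℕ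
schurTerm c d n a b = 𝟙 (d + a + b <? n) * monochromatic c a b (d + a + b)

-- Ordered pairs (a, b) with a, b, d + a + b all in {0,…,n−1} and of one colour. Shifting [n] down by
-- one, as Defs does, the Schur solutions of a colouring of [n] are the case d = 1.
schurCount : ∀ {k} → (ℕ → Fin k) → ℕ → ℕ → ℕ
schurCount c d n = ∑²[ a , b < n ] schurTerm c d n a b

schurCount-mono-≤ : ∀ {k} (c : ℕ → Fin k) d {m n} → m ≤ n → schurCount c d m ≤ schurCount c d n
schurCount-mono-≤ c d {m} {n} m≤n = begin
  ∑²[ a , b < m ] schurTerm c d m a b  ≤⟨ ∑²-monoʳ-≤ m (λ a b _ _ → *-monoˡ-≤ _
                                            (𝟙-mono (d + a + b <? m) (d + a + b <? n) (λ s<m → <-≤-trans s<m m≤n))) ⟩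
  ∑²[ a , b < m ] schurTerm c d n a b  ≤⟨ ∑²-monoˡ-≤ (schurTerm c d n) m≤n ⟩
  ∑²[ a , b < n ] schurTerm c d n a b  ∎

length-filter≡sum : ∀ {a p} {A : Set a} {P : A → Set p} (P? : Decidable P) xs →
                    length (filter P? xs) ≡ sum (map (𝟙 ∘ P?) xs)
length-filter≡sum P? []       = refl
length-filter≡sum P? (x ∷ xs) with does (P? x)
... | true  = cong suc (length-filter≡sum P? xs)
... | false = length-filter≡sum P? xs

sum-map-cartesianProduct : ∀ {a b} {A : Set a} {B : Set b} (f : A × B → ℕ) xs ys →
                           sum (map f (cartesianProduct xs ys)) ≡ sum (map (λ x → sum (map (λ y → f (x , y)) ys)) xs)
sum-map-cartesianProduct f []       ys = refl
sum-map-cartesianProduct f (x ∷ xs) ys = begin-equality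
  sum (map f (map (x ,_) ys ++ cartesianProduct xs ys))              ≡⟨ cong sum (map-++ f (map (x ,_) ys) _) ⟩
  sum (map f (map (x ,_) ys) ++ map f (cartesianProduct xs ys))      ≡⟨ sum-++ (map f (map (x ,_) ys)) _ ⟩
  sum (map f (map (x ,_) ys)) + sum (map f (cartesianProduct xs ys)) ≡⟨ cong₂ _+_ (cong sum (sym (map-∘ ys)))
                                                                           (sum-map-cartesianProduct f xs ys) ⟩
  sum (map (λ y → f (x , y)) ys) + _                                 ∎

sum-map-allFin-≤ : ∀ n (f : Fin n → ℕ) (g : ℕ → ℕ) → (∀ i → f i ≤ g (toℕ i)) → sum (map f (allFin n)) ≤ ∑ n g
sum-map-allFin-≤ n f g f≤g = ≤-trans (≤-reflexive (cong sum (map-tabulate id f))) (sum-tabulate-≤ n f g f≤g)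
  where
  sum-tabulate-≤ : ∀ n (f : Fin n → ℕ) (g : ℕ → ℕ) → (∀ i → f i ≤ g (toℕ i)) → sum (tabulate f) ≤ ∑ n g
  sum-tabulate-≤ zero    f g f≤g = z≤n
  sum-tabulate-≤ (suc n) f g f≤g = begin
    f Fin.zero + sum (tabulate (f ∘ Fin.suc))  ≤⟨ +-mono-≤ (f≤g Fin.zero) (sum-tabulate-≤ n _ (g ∘ suc) (f≤g ∘ Fin.suc)) ⟩
    g 0 + ∑ n (g ∘ suc)                        ≡⟨ ∑-head n g ⟨
    ∑ (suc n) g                                ∎

restrict : ∀ {k} n → (ℕ → Fin k) → Coloring n k
restrict n c = Vec.tabulate (c ∘ toℕ)

𝟙-isMonoSol≤ : ∀ {k} n (c : ℕ → Fin k) (x y z : Fin n) →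
               let s = 1 + toℕ x + toℕ y in
               𝟙 (isMonoSol? (restrict n c) (x , y , z)) ≤ 𝟙 (toℕ z ≟ s) * monochromatic c (toℕ x) (toℕ y) s
𝟙-isMonoSol≤ n c x y z = 𝟙≤ (isMonoSol? χ (x , y , z)) λ (x+y≡z , χx≡χy , χy≡χz) →
  let z≡s : toℕ z ≡ 1 + toℕ x + toℕ y
      z≡s = trans (sym (suc-injective x+y≡z)) (+-suc (toℕ x) (toℕ y))
      cx≡cy = trans (sym (χ≡c x)) (trans χx≡χy (χ≡c y))
      cy≡cs = trans (sym (χ≡c y)) (trans χy≡χz (trans (χ≡c z) (cong c z≡s)))
  in ≤-reflexive (sym (cong₂ _*_ (𝟙-yes (toℕ z ≟ _) z≡s)
                        (cong₂ _*_ (𝟙-yes (c _ ≟ᶠ c _) cx≡cy) (𝟙-yes (c _ ≟ᶠ c _) cy≡cs))))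
  where
  χ = restrict n c
  χ≡c : ∀ i → lookup χ i ≡ c (toℕ i)
  χ≡c = lookup∘tabulate (c ∘ toℕ)

monoCount-restrict≤schurCount : ∀ {k} n (c : ℕ → Fin k) → monoCount (restrict n c) ≤ schurCount c 1 n
monoCount-restrict≤schurCount n c = begin
  monoCount χ                                                ≡⟨ length-filter≡sum (isMonoSol? χ) (triples n) ⟩
  sum (map P (triples n))                                    ≡⟨ sum-map-cartesianProduct P (allFin n) _ ⟩
  sum (map (λ x → sum (map (λ yz → P (x , yz)) pairs)) (allFin n))
    ≤⟨ sum-map-allFin-≤ n _ _ row ⟩
  ∑[ a < n ] ∑[ b < n ] ∑[ z < n ] 𝟙 (z ≟ 1 + a + b) * monochromatic c a b (1 + a + b)
    ≡⟨ ∑²-cong n (λ a b _ _ → trans (∑-*ʳ n _ (λ z → 𝟙 (z ≟ 1 + a + b))) (cong (_* _) (∑-𝟙[≡] n _))) ⟩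
  schurCount c 1 n                                           ∎
  where
  χ = restrict n c
  P = 𝟙 ∘ isMonoSol? χ
  pairs = cartesianProduct (allFin n) (allFin n)
  row : ∀ x → sum (map (λ yz → P (x , yz)) pairs) ≤
              (∑[ b < n ] ∑[ z < n ] 𝟙 (z ≟ 1 + toℕ x + b) * monochromatic c (toℕ x) b (1 + toℕ x + b))
  row x = begin
    sum (map (λ yz → P (x , yz)) pairs)                                  ≡⟨ sum-map-cartesianProduct _ (allFin n) _ ⟩
    sum (map (λ y → sum (map (λ z → P (x , y , z)) (allFin n))) (allFin n))
      ≤⟨ sum-map-allFin-≤ n _ _ (λ y → sum-map-allFin-≤ n _ _ (𝟙-isMonoSol≤ n c x y)) ⟩
    _ ∎

∈-allColorings : ∀ n k (χ : Coloring n k) → χ ∈ allColorings n k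
∈-allColorings zero    k []      = here refl
∈-allColorings (suc n) k (a ∷ χ) = ∈-cartesianProductWith⁺ _∷_ (∈-allFin a) (∈-allColorings n k χ)

MSchur≤monoCount : ∀ n k (χ : Coloring n k) → MSchur n k ≤ monoCount χ
MSchur≤monoCount n k χ =
  min≤v⁺ (n ^ 3) _ (inj₂ (Any.map (≤-reflexive ∘ sym) (∈-map⁺ monoCount (∈-allColorings n k χ))))

-- Blowing up a template

-- Offsets (p, q) in blocks of length T for which 1 + p + q stays in a block or carries into the next.
lowPairs carryPairs : ℕ → ℕ
lowPairs   T = ∑²[ p , q < T ] 𝟙 (suc (p + q) <? T)
carryPairs T = ∑²[ p , q < T ] 𝟙 (T ≤? suc (p + q))

lowPairs+carryPairs : ∀ T → lowPairs T + carryPairs T ≡ T * T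
lowPairs+carryPairs T = begin-equality
  lowPairs T + carryPairs T                                      ≡⟨ ∑²-+ T _ _ ⟨
  ∑²[ p , q < T ] (𝟙 (suc (p + q) <? T) + 𝟙 (T ≤? suc (p + q)))  ≡⟨ ∑²-cong T (λ p q _ _ → 𝟙[<]+𝟙[≥] _ T) ⟩
  ∑²[ p , q < T ] 1                                              ≡⟨ ∑²-const T 1 ⟩
  T * T * 1                                                      ≡⟨ *-identityʳ (T * T) ⟩
  T * T                                                          ∎

carryPairs-row : ∀ {T p} → p < T → ∑[ q < T ] 𝟙 (T ≤? suc (p + q)) ≡ suc p
carryPairs-row {T} {p} p<T = begin-equality
  ∑[ q < T ] 𝟙 (T ≤? suc (p + q))  ≡⟨ ∑-cong T (λ q _ → 𝟙-cong (T ≤? suc (p + q)) (r ≤? q) to from) ⟩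
  ∑[ q < T ] 𝟙 (r ≤? q)            ≡⟨ ∑-𝟙[≤] T r ⟩
  T ∸ r                            ≡⟨ m∸[m∸n]≡n p<T ⟩
  suc p                            ∎
  where
  r = T ∸ suc p
  to : ∀ {q} → T ≤ suc (p + q) → r ≤ q
  to {q} T≤ = ≤-trans (∸-monoˡ-≤ (suc p) T≤) (≤-reflexive (m+n∸m≡n (suc p) q))
  from : ∀ {q} → r ≤ q → T ≤ suc (p + q)
  from {q} r≤q = ≤-trans (≤-reflexive (sym (m+[n∸m]≡n p<T))) (+-monoʳ-≤ (suc p) r≤q)

carryPairs-double : ∀ T → 2 * carryPairs T ≡ T * T + T
carryPairs-double T = trans (cong (2 *_) (∑-cong T λ p p<T → carryPairs-row p<T)) (double-∑-suc T)

lowPairs-double : ∀ T → 2 * lowPairs T ≤ T * T + T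
lowPairs-double T = +-cancelʳ-≤ (T * T + T) _ _ (begin
  2 * lowPairs T + (T * T + T)             ≡⟨ cong (2 * lowPairs T +_) (carryPairs-double T) ⟨
  2 * lowPairs T + 2 * carryPairs T        ≡⟨ *-distribˡ-+ 2 (lowPairs T) _ ⟨
  2 * (lowPairs T + carryPairs T)          ≡⟨ cong (2 *_) (lowPairs+carryPairs T) ⟩
  2 * (T * T)                              ≤⟨ *-monoʳ-≤ 2 (m≤m+n (T * T) T) ⟩
  2 * (T * T + T)                          ≡⟨ cong (T * T + T +_) (+-identityʳ (T * T + T)) ⟩
  (T * T + T) + (T * T + T)                ∎)

blowUp : ∀ {k} → (ℕ → Fin k) → (T : ℕ) .{{_ : NonZero T}} → ℕ → Fin k
blowUp c T a = c (a / T)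

[i*T+p]/T : ∀ i p T .{{_ : NonZero T}} → (i * T + p) / T ≡ i + p / T
[i*T+p]/T i p T = trans (+-distrib-/-∣ˡ p (n∣m*n i)) (cong (_+ p / T) (m*n/n≡m i T))

carry-≤ : ∀ {p q T} .{{_ : NonZero T}} → p < T → q < T → (g : ℕ → ℕ) →
          g (suc (p + q) / T) ≤ 𝟙 (suc (p + q) <? T) * g 0 + 𝟙 (T ≤? suc (p + q)) * g 1
carry-≤ {p} {q} {T} p<T q<T g with suc (p + q) <? T
... | yes s<T = begin
  g (s / T)                                  ≡⟨ cong g (m<n⇒m/n≡0 s<T) ⟩
  g 0                                        ≡⟨ trans (+-identityʳ _) (*-identityˡ (g 0)) ⟨
  1 * g 0 + 0 * g 1                          ≡⟨ cong₂ (λ u v → u * g 0 + v * g 1) (𝟙-yes (s <? T) s<T) (𝟙-no (T ≤? s) (<⇒≱ s<T)) ⟨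
  𝟙 (s <? T) * g 0 + 𝟙 (T ≤? s) * g 1       ∎
  where s = suc (p + q)
... | no  s≮T = begin
  g (s / T)                                  ≡⟨ cong g s/T≡1 ⟩
  g 1                                        ≡⟨ *-identityˡ (g 1) ⟨
  0 * g 0 + 1 * g 1                          ≡⟨ cong₂ (λ u v → u * g 0 + v * g 1) (𝟙-no (s <? T) s≮T) (𝟙-yes (T ≤? s) (≮⇒≥ s≮T)) ⟨
  𝟙 (s <? T) * g 0 + 𝟙 (T ≤? s) * g 1       ∎
  where
  s = suc (p + q)
  s<2T : s < 2 * T
  s<2T = begin-strict
    suc (p + q)   ≡⟨ +-suc p q ⟨
    p + suc q     <⟨ +-mono-<-≤ p<T q<T ⟩
    T + T         ≡⟨ cong (T +_) (+-identityʳ T) ⟨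
    2 * T         ∎
  s/T≡1 : s / T ≡ 1
  s/T≡1 = ≤-antisym (≤-pred (m<n*o⇒m/o<n s<2T)) (m≥n⇒m/n>0 (≮⇒≥ s≮T))

schurTerm-blowUp-≤ : ∀ {k} (c : ℕ → Fin k) L T .{{_ : NonZero T}} {i j p q} → p < T → q < T →
                     schurTerm (blowUp c T) 1 (L * T) (i * T + p) (j * T + q) ≤ schurTerm c (suc (p + q) / T) L i j
schurTerm-blowUp-≤ c L T {i} {j} {p} {q} p<T q<T =
  *-mono-≤ (𝟙-mono (s <? L * T) (e + i + j <? L) (subst (_< L) s/T≡ ∘ m<n*o⇒m/o<n))
           (≤-reflexive (trans (cong₂ (λ x y → monochromatic c x y (s / T)) (block/T p<T) (block/T q<T))
                               (cong (monochromatic c i j) s/T≡)))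
  where
  s = 1 + (i * T + p) + (j * T + q)
  e = suc (p + q) / T
  block/T : ∀ {i r} → r < T → (i * T + r) / T ≡ i
  block/T {i} {r} r<T = trans ([i*T+p]/T i r T) (trans (cong (i +_) (m<n⇒m/n≡0 r<T)) (+-identityʳ i))
  regroup : ∀ i j p q T → 1 + (i * T + p) + (j * T + q) ≡ (i + j) * T + suc (p + q)
  regroup = solve-∀
  s/T≡ : s / T ≡ e + i + j
  s/T≡ = begin-equality
    s / T                              ≡⟨ cong (_/ T) (regroup i j p q T) ⟩
    ((i + j) * T + suc (p + q)) / T    ≡⟨ [i*T+p]/T (i + j) (suc (p + q)) T ⟩
    i + j + e                          ≡⟨ +-comm (i + j) e ⟩
    e + (i + j)                        ≡⟨ +-assoc e i j ⟨
    e + i + j                          ∎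

schurCount-blowUp-≤ : ∀ {k} (c : ℕ → Fin k) L T .{{_ : NonZero T}} →
                      schurCount (blowUp c T) 1 (L * T) ≤ lowPairs T * schurCount c 0 L + carryPairs T * schurCount c 1 L
schurCount-blowUp-≤ c L T = begin
  ∑²[ a , b < L * T ] schurTerm c′ 1 (L * T) a b
    ≡⟨ ∑²-blocks L T (schurTerm c′ 1 (L * T)) ⟩
  ∑²[ i , j < L ] ∑²[ p , q < T ] schurTerm c′ 1 (L * T) (i * T + p) (j * T + q)
    ≤⟨ ∑²-monoʳ-≤ L (λ i j _ _ → ∑²-monoʳ-≤ T λ p q p<T q<T →
         ≤-trans (schurTerm-blowUp-≤ c L T p<T q<T) (carry-≤ p<T q<T (λ e → schurTerm c e L i j))) ⟩
  ∑²[ i , j < L ] ∑²[ p , q < T ] (𝟙 (suc (p + q) <? T) * A i j + 𝟙 (T ≤? suc (p + q)) * B i j)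
    ≡⟨ ∑²-cong L (λ i j _ _ → trans (∑²-+ T _ _) (cong₂ _+_ (∑²-*ʳ T (A i j) _) (∑²-*ʳ T (B i j) _))) ⟩
  ∑²[ i , j < L ] (lowPairs T * A i j + carryPairs T * B i j)
    ≡⟨ trans (∑²-+ L _ _) (cong₂ _+_ (∑²-*ˡ L (lowPairs T) A) (∑²-*ˡ L (carryPairs T) B)) ⟩
  lowPairs T * schurCount c 0 L + carryPairs T * schurCount c 1 L ∎
  where
  c′ = blowUp c T
  A = schurTerm c 0 L
  B = schurTerm c 1 L

Balanced : ∀ {k} → (ℕ → Fin k) → ℕ → Set
Balanced c L = schurCount c 0 L + schurCount c 1 L ≤ 2 * L

balanced⇒schurCount-blowUp-≤ : ∀ {k} (c : ℕ → Fin k) L T .{{_ : NonZero T}} → Balanced c L →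
                               schurCount (blowUp c T) 1 (L * T) ≤ L * (T * T + T)
balanced⇒schurCount-blowUp-≤ c L T balanced = *-cancelˡ-≤ 2 (begin
  2 * schurCount (blowUp c T) 1 (L * T)     ≤⟨ *-monoʳ-≤ 2 (schurCount-blowUp-≤ c L T) ⟩
  2 * (lowPairs T * A + carryPairs T * B)   ≡⟨ distrib (lowPairs T) (carryPairs T) A B ⟩
  2 * lowPairs T * A + 2 * carryPairs T * B ≤⟨ +-mono-≤ (*-monoˡ-≤ A (lowPairs-double T))
                                                         (*-monoˡ-≤ B (≤-reflexive (carryPairs-double T))) ⟩
  (T * T + T) * A + (T * T + T) * B         ≡⟨ *-distribˡ-+ (T * T + T) A B ⟨
  (T * T + T) * (A + B)                     ≤⟨ *-monoʳ-≤ (T * T + T) balanced ⟩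
  (T * T + T) * (2 * L)                     ≡⟨ regroup (T * T + T) L ⟩
  2 * (L * (T * T + T))                     ∎)
  where
  A = schurCount c 0 L
  B = schurCount c 1 L
  distrib : ∀ x y a b → 2 * (x * a + y * b) ≡ 2 * x * a + 2 * y * b
  distrib = solve-∀
  regroup : ∀ u L → u * (2 * L) ≡ 2 * (L * u)
  regroup = solve-∀

balanced⇒L*MSchur≤ : ∀ {k} (c : ℕ → Fin k) L .{{_ : NonZero L}} → Balanced c L →
                     ∀ n → L * MSchur n k ≤ (n + L) * (n + L) + L * (n + L)
balanced⇒L*MSchur≤ {k} c L balanced n = begin
  L * MSchur n k                   ≤⟨ *-monoʳ-≤ L MSchur≤ ⟩
  L * (L * (T * T + T))            ≡⟨ regroup L T ⟩
  L * T * (L * T) + L * (L * T)    ≤⟨ +-mono-≤ (*-mono-≤ L*T≤n+L L*T≤n+L) (*-monoʳ-≤ L L*T≤n+L) ⟩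
  (n + L) * (n + L) + L * (n + L)  ∎
  where
  T = suc (n / L)
  c′ = blowUp c T
  L*T≡ : L * T ≡ L + n / L * L
  L*T≡ = trans (*-suc L (n / L)) (cong (L +_) (*-comm L (n / L)))
  n≤L*T : n ≤ L * T
  n≤L*T = begin
    n                    ≡⟨ m≡m%n+[m/n]*n n L ⟩
    n % L + n / L * L    ≤⟨ +-monoˡ-≤ (n / L * L) (<⇒≤ (m%n<n n L)) ⟩
    L + n / L * L        ≡⟨ L*T≡ ⟨
    L * T                ∎
  L*T≤n+L : L * T ≤ n + L
  L*T≤n+L = begin
    L * T                ≡⟨ L*T≡ ⟩
    L + n / L * L        ≤⟨ +-monoʳ-≤ L (m/n*n≤m n L) ⟩
    L + n                ≡⟨ +-comm L n ⟩
    n + L                ∎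
  MSchur≤ : MSchur n k ≤ L * (T * T + T)
  MSchur≤ = begin
    MSchur n k                 ≤⟨ MSchur≤monoCount n k (restrict n c′) ⟩
    monoCount (restrict n c′)  ≤⟨ monoCount-restrict≤schurCount n c′ ⟩
    schurCount c′ 1 n          ≤⟨ schurCount-mono-≤ c′ 1 n≤L*T ⟩
    schurCount c′ 1 (L * T)    ≤⟨ balanced⇒schurCount-blowUp-≤ c L T balanced ⟩
    L * (T * T + T)            ∎
  regroup : ∀ L T → L * (L * (T * T + T)) ≡ L * T * (L * T) + L * (L * T)
  regroup = solve-∀

shifted-square-≤ : ∀ L n → 1 ≤ n → (n + L) * (n + L) + L * (n + L) ≤ n ^ 2 + (3 * L + 2 * (L * L)) * n
shifted-square-≤ L n 1≤n = begin
  (n + L) * (n + L) + L * (n + L)          ≡⟨ expand L n ⟩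
  n ^ 2 + 3 * L * n + 2 * (L * L) * 1      ≤⟨ +-monoʳ-≤ (n ^ 2 + 3 * L * n) (*-monoʳ-≤ (2 * (L * L)) 1≤n) ⟩
  n ^ 2 + 3 * L * n + 2 * (L * L) * n      ≡⟨ collect L n ⟩
  n ^ 2 + (3 * L + 2 * (L * L)) * n        ∎
  where
  expand : ∀ L n → (n + L) * (n + L) + L * (n + L) ≡ n * (n * 1) + 3 * L * n + 2 * (L * L) * 1
  expand = solve-∀
  collect : ∀ L n → n * (n * 1) + 3 * L * n + 2 * (L * L) * n ≡ n * (n * 1) + (3 * L + 2 * (L * L)) * n
  collect = solve-∀

balanced⇒L*MSchur≤n²+Cn : ∀ {k} (c : ℕ → Fin k) L .{{_ : NonZero L}} → Balanced c L →
                          ∀ n → 1 ≤ n → L * MSchur n k ≤ n ^ 2 + (3 * L + 2 * (L * L)) * n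
balanced⇒L*MSchur≤n²+Cn c L balanced n 1≤n =
  ≤-trans (balanced⇒L*MSchur≤ c L balanced n) (shifted-square-≤ L n 1≤n)

-- The templates

piecewise : ∀ {k} → List (ℕ × Fin (suc k)) → ℕ → Fin (suc k)
piecewise []                  i = Fin.zero
piecewise ((end , col) ∷ rs) i = if i <ᵇ end then col else piecewise rs i

c₃ : ℕ → Fin 3
c₃ = piecewise ((10 , 1F) ∷ (24 , 0F) ∷ (26 , 1F) ∷ (54 , 2F) ∷ (55 , 1F) ∷ (66 , 0F) ∷ (67 , 1F) ∷ [])

c₃-balanced : Balanced c₃ 67
c₃-balanced = ≤-refl

c₄ : ℕ → Fin 4
c₄ = piecewise ((28 , 1F) ∷ (66 , 0F) ∷ (71 , 1F) ∷ (146 , 2F) ∷ (148 , 1F) ∷ (178 , 0F) ∷ (180 , 1F) ∷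
  (259 , 3F) ∷ (261 , 0F) ∷ (263 , 3F) ∷ (264 , 0F) ∷ (266 , 3F) ∷ (268 , 0F) ∷ (269 , 3F) ∷ (273 , 0F) ∷
  (276 , 3F) ∷ (277 , 0F) ∷ (279 , 3F) ∷ (280 , 0F) ∷ (282 , 3F) ∷ (284 , 0F) ∷ (285 , 3F) ∷ (287 , 0F) ∷
  (362 , 3F) ∷ (363 , 1F) ∷ (392 , 0F) ∷ (393 , 1F) ∷ (465 , 2F) ∷ (466 , 1F) ∷ (495 , 0F) ∷ (496 , 1F) ∷ [])

c₄-balanced : Balanced c₄ 496
c₄-balanced = ≤-refl

theorem7 : ∃[ C ] ∃[ N ] ((n : ℕ) → N ≤ n →
               (67 * MSchur n 3 ≤ n ^ 2 + C * n) × (496 * MSchur n 4 ≤ n ^ 2 + C * n))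
theorem7 = C , 1 , λ n 1≤n →
    ≤-trans (balanced⇒L*MSchur≤n²+Cn c₃ 67 c₃-balanced n 1≤n) (+-monoʳ-≤ (n ^ 2) (*-monoˡ-≤ n C₃≤C))
  , balanced⇒L*MSchur≤n²+Cn c₄ 496 c₄-balanced n 1≤n
  where
  C = 3 * 496 + 2 * (496 * 496)
  C₃≤C : 3 * 67 + 2 * (67 * 67) ≤ C
  C₃≤C = from-yes (3 * 67 + 2 * (67 * 67) ≤? C)
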